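{- For odd positive integers $n$, $s(n) - s(n+1) = O(\log\log n)$ as $n\to\infty$; that is, there is a constant $C>0$ such that $s(n) - s(n+1) \le C \log\log n$ for all sufficiently large odd $n$.
   Context: $n \bmod k$ denotes the least nonnegative remainder of $n$ upon division by $k$. $S(n) := \{ n \bmod k : k \in \{1,2,\ldots,\lfloor n/2\rfloor\}\}$ and $s(n) := |S(n)|$. -}

module Defs where

open import Data.Nat using (ℕ; suc; _≟_)
open import Data.Nat.DivMod using (_/_; _%_)
open import Data.List using (List; map; upTo; length; deduplicate)

residues : ℕ → List ℕ
residues n = map (λ i → n % suc i) (upTo (n / 2))

S : ℕ → List ℕ
S n = deduplicate _≟_ (residues n)

s : ℕ → ℕ
s n = length (S n)

{-# OPTIONS --safe #-}
module Submission where

-- Let k ≤ n/2 and r = n mod k. If r + 1 < k then r + 1 = (n + 1) mod k lies in S(n + 1).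
-- Otherwise n + 1 = (c + 1) k with c = ⌊n/k⌋ ≥ 2. If k = d e with 2 ≤ e < c, then k' = c d
-- satisfies n + 1 = k + e k' and k < k' ≤ (n + 1)/2, so again r + 1 = (n + 1) mod k' lies in
-- S(n + 1). Thus r ↦ r + 1 maps S(n) into S(n + 1) except on the residues k - 1 for which
-- k = (n + 1)/(c + 1) is c-rough. For two such exceptional quotients a < b, either b = a + 1
-- or a² < b: if a + 1 shares a factor with the b-rough number (n + 1)/(b + 1) then b ≤ a + 1;
-- otherwise a + 1 ∣ b + 1, and t = (b + 1)/(a + 1) ≥ 2 divides the a-rough number
-- (n + 1)/(a + 1), so t ≥ a. Every second exceptional quotient therefore at least squares,
-- and there are O(log log n) of them below n.

open import Level using (Level)
open import Defs
open import Data.Nat using (ℕ; zero; suc; pred; _+_; _*_; _^_; _≤_; _<_;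
  z≤n; s≤s; NonZero; NonTrivial; ≢-nonZero; ≢-nonZero⁻¹; >-nonZero; nonTrivial⇒n>1; ⌊_/2⌋; ⌈_/2⌉)
open import Data.Nat.Properties
open import Data.Nat.DivMod
open import Data.Nat.Divisibility using (_∣_; divides; _∣?_; ∣⇒≤; 0∣⇒≡0; m∣m*n;
  _HasNonTrivialDivisorLessThan_; hasNonTrivialDivisor)
open import Data.Nat.Coprimality using (Coprime; coprime-divisor)
open import Data.Nat.Primality using (_Rough_; rough⇒≤; rough∧∣⇒rough)
open import Data.Nat.Logarithm using (⌊log₂_⌋; ⌊log₂⌋-mono-≤; ⌊log₂[2^n]⌋≡n)
open import Data.List using (List; []; _∷_; _++_; map; filter; upTo; length)
open import Data.List.Properties using (length-++; length-map; length-removeAt′)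
open import Data.List.Membership.Propositional using (_∈_)
open import Data.List.Membership.Propositional.Properties
  using (∈-map⁺; ∈-map⁻; ∈-filter⁺; ∈-upTo⁺; ∈-upTo⁻; ∈-deduplicate⁺; ∈-deduplicate⁻;
         ∈-++⁺ˡ; ∈-++⁺ʳ)
open import Data.List.Relation.Binary.Subset.Propositional using (_⊆_)
open import Data.List.Relation.Unary.Any using (here; there; index; _─_)
open import Data.List.Relation.Unary.All as All using (All; _∷_)
import Data.List.Relation.Unary.All.Properties as All
open import Data.List.Relation.Unary.AllPairs using (AllPairs; []; _∷_)
import Data.List.Relation.Unary.AllPairs.Properties as AllPairs
open import Data.List.Relation.Unary.Unique.Propositional using (Unique)
open import Data.List.Relation.Unary.Unique.DecPropositional.Properties using (deduplicate-!)
open import Data.Product using (∃-syntax; _×_; _,_; proj₁)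
open import Data.Sum using (_⊎_; inj₁; inj₂; [_,_]′)
open import Function using (id; _∘_)
open import Relation.Nullary using (Dec; yes; no; ¬?; contradiction)
open import Relation.Nullary.Decidable using (map′; _×-dec_; recompute)
open import Relation.Unary using (Pred; Decidable)
open import Relation.Binary.PropositionalEquality

private
  variable
    a : Level
    A : Set a

∈-─⁺ : ∀ {x y : A} {xs} (x∈xs : x ∈ xs) → y ∈ xs → y ≢ x → y ∈ (xs ─ x∈xs)
∈-─⁺ (here refl)  (here refl)  y≢x = contradiction refl y≢x
∈-─⁺ (here _)     (there y∈xs) _   = y∈xs
∈-─⁺ (there _)    (here y≡z)   _   = here y≡z
∈-─⁺ (there x∈xs) (there y∈xs) y≢x = there (∈-─⁺ x∈xs y∈xs y≢x)

unique∧⊆⇒length≤ : ∀ {xs ys : List A} → Unique xs → xs ⊆ ys → length xs ≤ length ys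
unique∧⊆⇒length≤ [] _ = z≤n
unique∧⊆⇒length≤ {xs = x ∷ xs} {ys} (x∉xs ∷ xs!) xs⊆ys = begin
  suc (length xs)          ≤⟨ s≤s (unique∧⊆⇒length≤ xs! xs⊆ys─x) ⟩
  suc (length (ys ─ x∈ys)) ≡⟨ length-removeAt′ ys (index x∈ys) ⟨
  length ys                ∎
  where
  open ≤-Reasoning
  x∈ys : x ∈ ys
  x∈ys = xs⊆ys (here refl)
  xs⊆ys─x : xs ⊆ (ys ─ x∈ys)
  xs⊆ys─x y∈xs = ∈-─⁺ x∈ys (xs⊆ys (there y∈xs)) (All.lookup x∉xs y∈xs ∘ sym)

_hasNonTrivialDivisorLessThan?_ : ∀ m n → Dec (m HasNonTrivialDivisorLessThan n)
m hasNonTrivialDivisorLessThan? n =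
  map′ fromBounded toBounded (anyUpTo? (λ d → nonTrivial? d ×-dec d ∣? m) n)
  where
  fromBounded : ∃[ d ] (d < n × NonTrivial d × d ∣ m) → m HasNonTrivialDivisorLessThan n
  fromBounded (_ , d<n , d-nontrivial , d∣m) = hasNonTrivialDivisor {{d-nontrivial}} d<n d∣m
  toBounded : m HasNonTrivialDivisorLessThan n → ∃[ d ] (d < n × NonTrivial d × d ∣ m)
  toBounded (hasNonTrivialDivisor {d} {{d-nontrivial}} d<n d∣m) =
    d , d<n , recompute (nonTrivial? d) d-nontrivial , d∣m

rough⇒coprime : ∀ {m b B} .{{_ : NonZero m}} → m < b → b Rough B → Coprime m B
rough⇒coprime {m} _ _ {zero} (0∣m , _) = contradiction (0∣⇒≡0 0∣m) (≢-nonZero⁻¹ m)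
rough⇒coprime _ _ {suc zero} _ = refl
rough⇒coprime m<b b-rough {suc (suc _)} (d∣m , d∣B) =
  contradiction (rough⇒≤ (rough∧∣⇒rough b-rough d∣B)) (<⇒≱ (≤-<-trans (∣⇒≤ d∣m) m<b))

rough-cofactors⇒≡suc⊎square< : ∀ {a b A B} → suc a * A ≡ suc b * B → a Rough A → b Rough B →
                                a < b → b ≡ suc a ⊎ a * a < b
rough-cofactors⇒≡suc⊎square< {a} {b} {A} {B} eq a-rough b-rough a<b with m≤n⇒m<n∨m≡n a<b
... | inj₂ 1+a≡b = inj₁ (sym 1+a≡b)
... | inj₁ 1+a<b with coprime-divisor (rough⇒coprime 1+a<b b-rough)
                        (subst (suc a ∣_) (trans eq (*-comm (suc b) B)) (m∣m*n A))
...   | divides (suc zero) 1+b≡1+a+0 =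
  contradiction (trans (suc-injective 1+b≡1+a+0) (+-identityʳ a)) (≢-sym (<⇒≢ a<b))
...   | divides t@(suc (suc t′)) 1+b≡t*[1+a] = inj₂ (≤-pred (begin
  2 + a * a   ≤⟨ +-mono-≤ (s≤s (s≤s (z≤n {t′}))) (*-monoˡ-≤ a a≤t) ⟩
  t + t * a   ≡⟨ *-suc t a ⟨
  t * suc a   ≡⟨ 1+b≡t*[1+a] ⟨
  suc b       ∎))
  where
  open ≤-Reasoning
  A≡B*t : A ≡ B * t
  A≡B*t = *-cancelˡ-≡ A (B * t) (suc a) (begin-equality
    suc a * A       ≡⟨ eq ⟩
    suc b * B       ≡⟨ cong (_* B) 1+b≡t*[1+a] ⟩
    t * suc a * B   ≡⟨ cong (_* B) (*-comm t (suc a)) ⟩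
    suc a * t * B   ≡⟨ *-assoc (suc a) t B ⟩
    suc a * (t * B) ≡⟨ cong (suc a *_) (*-comm t B) ⟩
    suc a * (B * t) ∎)
  a≤t : a ≤ t
  a≤t = rough⇒≤ (rough∧∣⇒rough a-rough (divides B A≡B*t))

2^n≤m⇒n≤⌊log₂m⌋ : ∀ {n m} → 2 ^ n ≤ m → n ≤ ⌊log₂ m ⌋
2^n≤m⇒n≤⌊log₂m⌋ {n} 2^n≤m = subst (_≤ _) (⌊log₂[2^n]⌋≡n n) (⌊log₂⌋-mono-≤ 2^n≤m)

2^2^n≤m⇒n≤⌊log₂⌊log₂m⌋⌋ : ∀ {n m} → 2 ^ (2 ^ n) ≤ m → n ≤ ⌊log₂ ⌊log₂ m ⌋ ⌋
2^2^n≤m⇒n≤⌊log₂⌊log₂m⌋⌋ = 2^n≤m⇒n≤⌊log₂m⌋ ∘ 2^n≤m⇒n≤⌊log₂m⌋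

⌊n/2⌋≤m⇒n<2*[1+m] : ∀ {n m} → ⌊ n /2⌋ ≤ m → n < 2 * suc m
⌊n/2⌋≤m⇒n<2*[1+m] {n} {m} ⌊n/2⌋≤m = begin-strict
  n                   ≡⟨ ⌊n/2⌋+⌈n/2⌉≡n n ⟨
  ⌊ n /2⌋ + ⌈ n /2⌉   ≤⟨ +-mono-≤ ⌊n/2⌋≤m (≤-trans (⌊n/2⌋-mono (n≤1+n (suc n))) (s≤s ⌊n/2⌋≤m)) ⟩
  m + suc m           <⟨ n<1+n (m + suc m) ⟩
  suc m + suc m       ≡⟨ cong (suc m +_) (+-identityʳ (suc m)) ⟨
  2 * suc m           ∎
  where open ≤-Reasoning

module _ {p} {P : Pred ℕ p} (gap : ∀ {a b} → P a → P b → a < b → b ≡ suc a ⊎ a * a < b) where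

  ^[2^⌊length/2⌋]≤ : ∀ {n x xs} → AllPairs _<_ (x ∷ xs) → All P (x ∷ xs) → All (_≤ n) (x ∷ xs) →
                     x ^ (2 ^ ⌊ length xs /2⌋) ≤ n
  ^[2^⌊length/2⌋]≤ {x = x} {[]}     _ _ (x≤n ∷ _) = subst (_≤ _) (sym (*-identityʳ x)) x≤n
  ^[2^⌊length/2⌋]≤ {x = x} {_ ∷ []} _ _ (x≤n ∷ _) = subst (_≤ _) (sym (*-identityʳ x)) x≤n
  ^[2^⌊length/2⌋]≤ {n} {x} {y ∷ w ∷ zs}
    ((x<y ∷ x<w ∷ _) ∷ (y<w ∷ _) ∷ sorted) (Px ∷ _ ∷ Pws@(Pw ∷ _)) (_ ∷ _ ∷ bounded) = begin
    x ^ (2 ^ suc k)    ≡⟨ ^-*-assoc x 2 (2 ^ k) ⟨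
    (x ^ 2) ^ (2 ^ k)  ≤⟨ ^-monoˡ-≤ (2 ^ k) x^2≤w ⟩
    w ^ (2 ^ k)        ≤⟨ ^[2^⌊length/2⌋]≤ sorted Pws bounded ⟩
    n                  ∎
    where
    open ≤-Reasoning
    k : ℕ
    k = ⌊ length zs /2⌋
    x*x<w : x * x < w
    x*x<w with gap Px Pw x<w
    ... | inj₁ refl   = contradiction y<w (≤⇒≯ x<y)
    ... | inj₂ x*x<w′ = x*x<w′
    x^2≤w : x ^ 2 ≤ w
    x^2≤w = subst (_≤ w) (cong (x *_) (sym (*-identityʳ x))) (<⇒≤ x*x<w)

  length≤2*[1+⌊log₂⌊log₂n⌋⌋] : ∀ {n xs} → AllPairs _<_ xs → All P xs → All (2 ≤_) xs →
                               All (_≤ n) xs →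
                               length xs ≤ 2 * suc ⌊log₂ ⌊log₂ n ⌋ ⌋
  length≤2*[1+⌊log₂⌊log₂n⌋⌋] {xs = []} _ _ _ _ = z≤n
  length≤2*[1+⌊log₂⌊log₂n⌋⌋] {xs = x ∷ xs} sorted Ps (2≤x ∷ _) bounded =
    ⌊n/2⌋≤m⇒n<2*[1+m] (2^2^n≤m⇒n≤⌊log₂⌊log₂m⌋⌋
      (≤-trans (^-monoˡ-≤ (2 ^ ⌊ length xs /2⌋) 2≤x) (^[2^⌊length/2⌋]≤ sorted Ps bounded)))

∈-S⁺ : ∀ {n k} .{{_ : NonZero k}} → k ≤ n / 2 → n % k ∈ S n
∈-S⁺ {n} {suc i} k≤n/2 = ∈-deduplicate⁺ _≟_ (∈-map⁺ (λ j → n % suc j) (∈-upTo⁺ k≤n/2))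

∈-S⁻ : ∀ {n r} → r ∈ S n → ∃[ i ] (suc i ≤ n / 2 × r ≡ n % suc i)
∈-S⁻ {n} r∈S
  with i , i∈upTo , r≡n%[1+i] ← ∈-map⁻ (λ j → n % suc j) (∈-deduplicate⁻ _≟_ (residues n) r∈S)
  = i , ∈-upTo⁻ i∈upTo , r≡n%[1+i]

S-unique : ∀ n → Unique (S n)
S-unique n = deduplicate-! _≟_ (residues n)

1+[m%n]<n⇒[1+m]%n≡1+[m%n] : ∀ m n .{{_ : NonZero n}} → suc (m % n) < n → suc m % n ≡ suc (m % n)
1+[m%n]<n⇒[1+m]%n≡1+[m%n] m n 1+[m%n]<n = begin
  suc m % n                        ≡⟨ %-congˡ (cong suc (m≡m%n+[m/n]*n m n)) ⟩
  (suc (m % n) + m / n * n) % n    ≡⟨ [m+kn]%n≡m%n (suc (m % n)) (m / n) n ⟩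
  suc (m % n) % n                  ≡⟨ m<n⇒m%n≡m 1+[m%n]<n ⟩
  suc (m % n)                      ∎
  where open ≡-Reasoning

1+[m%n]≡n⇒1+m≡[1+m/n]*n : ∀ m n .{{_ : NonZero n}} → suc (m % n) ≡ n → suc m ≡ suc (m / n) * n
1+[m%n]≡n⇒1+m≡[1+m/n]*n m n 1+[m%n]≡n =
  trans (cong suc (m≡m%n+[m/n]*n m n)) (cong (_+ m / n * n) 1+[m%n]≡n)

-- When n mod k = k - 1, i.e. n + 1 = (c + 1) k with c = ⌊n/k⌋, the modulus k is
-- recovered from the quotient c.
modulus : ℕ → ℕ → ℕ
modulus n c = suc n / suc c

Exceptional : ℕ → Pred ℕ _
Exceptional n c = 2 ≤ c × suc c ∣ suc n × c Rough modulus n c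

exceptional? : ∀ n → Decidable (Exceptional n)
exceptional? n c =
  2 ≤? c ×-dec suc c ∣? suc n ×-dec ¬? (modulus n c hasNonTrivialDivisorLessThan? c)

exceptional-gap : ∀ {n a b} → Exceptional n a → Exceptional n b → a < b → b ≡ suc a ⊎ a * a < b
exceptional-gap (_ , 1+a∣1+n , a-rough) (_ , 1+b∣1+n , b-rough) =
  rough-cofactors⇒≡suc⊎square< (trans (m*[n/m]≡n 1+a∣1+n) (sym (m*[n/m]≡n 1+b∣1+n))) a-rough b-rough

exceptionalQuotients : ℕ → List ℕ
exceptionalQuotients n = filter (exceptional? n) (upTo (suc n))

exceptionalResidues : ℕ → List ℕ
exceptionalResidues n = map (pred ∘ modulus n) (exceptionalQuotients n)

length-exceptionalResidues : ∀ n → length (exceptionalResidues n) ≤ 2 * suc ⌊log₂ ⌊log₂ n ⌋ ⌋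
length-exceptionalResidues n = begin
  length (exceptionalResidues n)  ≡⟨ length-map (pred ∘ modulus n) (exceptionalQuotients n) ⟩
  length (exceptionalQuotients n) ≤⟨ length≤2*[1+⌊log₂⌊log₂n⌋⌋] exceptional-gap sorted exceptional
                                       (All.map proj₁ exceptional) bounded ⟩
  2 * suc ⌊log₂ ⌊log₂ n ⌋ ⌋       ∎
  where
  open ≤-Reasoning
  sorted : AllPairs _<_ (exceptionalQuotients n)
  sorted = AllPairs.filter⁺ (exceptional? n) (AllPairs.applyUpTo⁺₁ id (suc n) (λ i<j _ → i<j))
  exceptional : All (Exceptional n) (exceptionalQuotients n)
  exceptional = All.all-filter (exceptional? n) (upTo (suc n))
  bounded : All (_≤ n) (exceptionalQuotients n)
  bounded = All.filter⁺ (exceptional? n) (All.map ≤-pred (All.all-upTo (suc n)))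

∈-exceptionalResidues : ∀ {n c k} .{{_ : NonZero k}} → suc n ≡ suc c * k → 2 ≤ c → c Rough k →
                        pred k ∈ exceptionalResidues n
∈-exceptionalResidues {n} {c} {k} 1+n≡[1+c]*k 2≤c c-rough =
  subst (_∈ exceptionalResidues n) (cong pred modulus≡k)
    (∈-map⁺ (pred ∘ modulus n) (∈-filter⁺ (exceptional? n) (∈-upTo⁺ c<1+n)
      (2≤c , divides k 1+n≡k*[1+c] , subst (c Rough_) (sym modulus≡k) c-rough)))
  where
  1+n≡k*[1+c] : suc n ≡ k * suc c
  1+n≡k*[1+c] = trans 1+n≡[1+c]*k (*-comm (suc c) k)
  modulus≡k : modulus n c ≡ k
  modulus≡k = trans (/-congˡ 1+n≡k*[1+c]) (m*n/n≡m k (suc c))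
  c<1+n : c < suc n
  c<1+n = subst (suc c ≤_) (sym 1+n≡[1+c]*k) (m≤m*n (suc c) k)

k≤n/2⇒2≤c : ∀ {n c k} → suc n ≡ suc c * k → k ≤ n / 2 → 2 ≤ c
k≤n/2⇒2≤c {n} {c} {k} 1+n≡[1+c]*k k≤n/2 = ≮⇒≥ λ c<2 → <-irrefl refl (begin-strict
  suc n        ≡⟨ 1+n≡[1+c]*k ⟩
  suc c * k    ≤⟨ *-monoˡ-≤ k c<2 ⟩
  2 * k        ≤⟨ *-monoʳ-≤ 2 k≤n/2 ⟩
  2 * (n / 2)  ≡⟨ *-comm 2 (n / 2) ⟩
  n / 2 * 2    ≤⟨ m/n*n≤m n 2 ⟩
  n            <⟨ n<1+n n ⟩
  suc n        ∎)
  where open ≤-Reasoning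

hasNonTrivialDivisorLessThan⇒∈S : ∀ {N c k} .{{_ : NonZero k}} → N ≡ suc c * k →
                                  k HasNonTrivialDivisorLessThan c → k ∈ S N
hasNonTrivialDivisorLessThan⇒∈S {N} {c} {k} N≡[1+c]*k
  (hasNonTrivialDivisor {e} e<c (divides d k≡d*e)) =
  subst (_∈ S N) N%k′≡k (∈-S⁺ k′≤N/2)
  where
  k′ : ℕ
  k′ = c * d
  instance
    d≢0 : NonZero d
    d≢0 = ≢-nonZero λ d≡0 → ≢-nonZero⁻¹ k (trans k≡d*e (cong (_* e) d≡0))
    c≢0 : NonZero c
    c≢0 = >-nonZero (≤-<-trans z≤n e<c)
    k′≢0 : NonZero k′
    k′≢0 = m*n≢0 c d
  N≡k+e*k′ : N ≡ k + e * k′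
  N≡k+e*k′ = begin
    N                 ≡⟨ N≡[1+c]*k ⟩
    k + c * k         ≡⟨ cong (λ x → k + c * x) k≡d*e ⟩
    k + c * (d * e)   ≡⟨ cong (k +_) (*-assoc c d e) ⟨
    k + c * d * e     ≡⟨ cong (k +_) (*-comm (c * d) e) ⟩
    k + e * (c * d)   ∎
    where open ≡-Reasoning
  k<k′ : k < k′
  k<k′ = subst₂ _<_ (sym k≡d*e) (*-comm d c) (*-monoʳ-< d e<c)
  N%k′≡k : N % k′ ≡ k
  N%k′≡k = begin
    N % k′              ≡⟨ %-congˡ {o = k′} N≡k+e*k′ ⟩
    (k + e * k′) % k′   ≡⟨ [m+kn]%n≡m%n k e k′ ⟩
    k % k′              ≡⟨ m<n⇒m%n≡m k<k′ ⟩
    k                   ∎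
    where open ≡-Reasoning
  k′≤N/2 : k′ ≤ N / 2
  k′≤N/2 = subst (_≤ N / 2) (m*n/n≡m k′ 2) (/-monoˡ-≤ 2 (begin
    k′ * 2         ≡⟨ *-comm k′ 2 ⟩
    2 * k′         ≤⟨ *-monoˡ-≤ k′ (nonTrivial⇒n>1 e) ⟩
    e * k′         ≤⟨ m≤n+m (e * k′) k ⟩
    k + e * k′     ≡⟨ N≡k+e*k′ ⟨
    N              ∎))
    where open ≤-Reasoning

∈-S-shift : ∀ n {r} → r ∈ S n → suc r ∈ S (suc n) ⊎ r ∈ exceptionalResidues n
∈-S-shift n r∈S with i , k≤n/2 , refl ← ∈-S⁻ {n} r∈S with m≤n⇒m<n∨m≡n (m%n<n n (suc i))
... | inj₁ 1+r<k = inj₁ (subst (_∈ S (suc n)) (1+[m%n]<n⇒[1+m]%n≡1+[m%n] n (suc i) 1+r<k)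
                          (∈-S⁺ {suc n} (≤-trans k≤n/2 (/-monoˡ-≤ 2 (n≤1+n n)))))
... | inj₂ 1+r≡k
  with 1+[m%n]≡n⇒1+m≡[1+m/n]*n n (suc i) 1+r≡k | suc i hasNonTrivialDivisorLessThan? (n / suc i)
...   | 1+n≡[1+c]*k | yes k-composite = inj₁ (subst (_∈ S (suc n)) (sym 1+r≡k)
          (hasNonTrivialDivisorLessThan⇒∈S 1+n≡[1+c]*k k-composite))
...   | 1+n≡[1+c]*k | no k-rough = inj₂ (subst (_∈ exceptionalResidues n) (cong pred (sym 1+r≡k))
          (∈-exceptionalResidues 1+n≡[1+c]*k (k≤n/2⇒2≤c 1+n≡[1+c]*k k≤n/2) k-rough))

s[n]≤s[1+n]+∣exceptionalResidues∣ : ∀ n → s n ≤ s (suc n) + length (exceptionalResidues n)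
s[n]≤s[1+n]+∣exceptionalResidues∣ n = begin
  s n
    ≤⟨ unique∧⊆⇒length≤ (S-unique n) S⊆ ⟩
  length (map pred (S (suc n)) ++ exceptionalResidues n)
    ≡⟨ length-++ (map pred (S (suc n))) ⟩
  length (map pred (S (suc n))) + length (exceptionalResidues n)
    ≡⟨ cong (_+ length (exceptionalResidues n)) (length-map pred (S (suc n))) ⟩
  s (suc n) + length (exceptionalResidues n)
    ∎
  where
  open ≤-Reasoning
  S⊆ : S n ⊆ map pred (S (suc n)) ++ exceptionalResidues n
  S⊆ r∈S = [ ∈-++⁺ˡ ∘ ∈-map⁺ pred , ∈-++⁺ʳ _ ]′ (∈-S-shift n r∈S)

2*[1+m]≤4*m : ∀ {m} → 1 ≤ m → 2 * suc m ≤ 4 * m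
2*[1+m]≤4*m {m} 1≤m = begin
  2 * suc m       ≡⟨ *-suc 2 m ⟩
  2 + 2 * m       ≤⟨ +-monoˡ-≤ (2 * m) (*-monoʳ-≤ 2 1≤m) ⟩
  2 * m + 2 * m   ≡⟨ *-distribʳ-+ m 2 2 ⟨
  4 * m           ∎
  where open ≤-Reasoning

proposition4p7 : ∃[ C ] ∃[ N ] (∀ (n : ℕ) → N ≤ n → n % 2 ≡ 1 →
    s n ≤ s (suc n) + C * ⌊log₂ ⌊log₂ n ⌋ ⌋)
proposition4p7 = 4 , 4 , λ n 4≤n _ → begin
  s n
    ≤⟨ s[n]≤s[1+n]+∣exceptionalResidues∣ n ⟩
  s (suc n) + length (exceptionalResidues n)
    ≤⟨ +-monoʳ-≤ (s (suc n)) (length-exceptionalResidues n) ⟩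
  s (suc n) + 2 * suc ⌊log₂ ⌊log₂ n ⌋ ⌋
    ≤⟨ +-monoʳ-≤ (s (suc n)) (2*[1+m]≤4*m (2^2^n≤m⇒n≤⌊log₂⌊log₂m⌋⌋ 4≤n)) ⟩
  s (suc n) + 4 * ⌊log₂ ⌊log₂ n ⌋ ⌋
    ∎
  where open ≤-Reasoning
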